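{- Let $k\geq 2$ and $b$ be integers with $1\leq b\leq k/2$, let $d=5\cdot 2^{k-b}$ and $z^*=d/2^{k-2b}=5\cdot 2^b$. Define, for $z>0$, \[ f(z)=(2^b-1)\left(1+\frac{1}{2^{k-2b}(2^b-1)\left(1+\frac{1}{2^{k-2b}z+2^{k-2b}-1}\right)^d+2^{k-2b}-1}\right)^{d}-z, \] \[ g(z)=(2^b-1)\left(1+\frac{1}{2^{k-2b}z+2^{k-2b}-1}\right)^d-z. \] Then $f(z^*)>0$ and $g(z^*)<0$. -}

module Defs where

open import Data.Nat as ℕ using (ℕ; zero; suc)
open import Data.Integer using (+_)
open import Data.Rational using (ℚ; 0ℚ; 1ℚ; _+_; _*_; _-_; 1/_; ≢-nonZero)
open import Data.Rational.Properties using (_≟_)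
open import Relation.Nullary using (yes; no)

ℕ→ℚ : ℕ → ℚ
ℕ→ℚ n = (+ n) Data.Rational./ 1

_^ℚ_ : ℚ → ℕ → ℚ
q ^ℚ zero  = 1ℚ
q ^ℚ suc n = q * (q ^ℚ n)

-- reciprocal, total: 1/q for q ≠ 0 (convention 0 for q = 0; never used
-- at the point z* where all denominators are positive)
inv : ℚ → ℚ
inv q with q ≟ 0ℚ
... | yes _ = 0ℚ
... | no q≢0 = 1/_ q {{≢-nonZero q≢0}}

dd : ℕ → ℕ → ℕ
dd k b = 5 ℕ.* 2 ℕ.^ (k ℕ.∸ b)

mm : ℕ → ℕ → ℚ
mm k b = ℕ→ℚ (2 ℕ.^ (k ℕ.∸ 2 ℕ.* b))

cc : ℕ → ℚ
cc b = ℕ→ℚ (2 ℕ.^ b) - 1ℚ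

zstar : ℕ → ℚ
zstar b = ℕ→ℚ (5 ℕ.* 2 ℕ.^ b)

inner : ℕ → ℕ → ℚ → ℚ
inner k b z = (1ℚ + inv (mm k b * z + mm k b - 1ℚ)) ^ℚ dd k b

gfun : ℕ → ℕ → ℚ → ℚ
gfun k b z = cc b * inner k b z - z

ffun : ℕ → ℕ → ℚ → ℚ
ffun k b z =
  cc b * ((1ℚ + inv (mm k b * cc b * inner k b z + mm k b - 1ℚ)) ^ℚ dd k b) - z

-- Write m = 2^(k-2b), c = 2^b - 1, so that z* = 5(c + 1) and d = m z*. When 20 divides d, say d = 20t,
-- the base N = m z* + m - 1 of the inner factor satisfies 20t ≤ N + 1. Since 1 - 1/(N+1) is the reciprocal
-- of 1 + 1/N, Bernoulli's inequality for it gives (1 + 1/N)^t ≤ 1/(1 - t/(N+1)) ≤ 20/19, so the inner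
-- factor is at most (20/19)^20 < 14/5 and c·14/5 < 5(c + 1) = z*: this is g(z*) < 0. For f, Bernoulli gives
-- (1 + 1/M)^(20t) ≥ (1 + t/M)^20 for the outer base M = m c I + m - 1 ≤ m(14c/5 + 1), hence
-- t/M ≥ (5c + 5)/(56c + 20), and c (1 + (5c + 5)/(56c + 20))^20 > 5(c + 1) is a numerical check.
-- The only case with 20 ∤ d is (k, b) = (2, 1).

module Submission where

open import Data.Empty using (⊥-elim)
open import Data.Integer as ℤ using (+_)
import Data.Integer.Properties as ℤₚ
open import Data.Nat as ℕ using (ℕ; zero; suc)
import Data.Nat.Properties as ℕₚ
open import Algebra.Properties.CommutativeSemigroup ℕₚ.*-commutativeSemigroup using (x∙yz≈y∙xz)
open import Data.Nat.Coprimality using (1-coprimeTo) renaming (sym to coprime-sym)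
open import Data.Product using (_×_; _,_; proj₂; Σ-syntax)
open import Data.Rational
  using (ℚ; mkℚ; 0ℚ; 1ℚ; _+_; _*_; _-_; -_; _/_; _≤_; _<_; _>_; ≢-nonZero;
         positive; nonNegative; nonPositive)
open import Data.Rational.Properties
open import Data.Rational.Solver using (module +-*-Solver)
open import Data.Sum using (_⊎_; inj₁; inj₂)
open import Relation.Nullary using (yes; no)
open import Relation.Nullary.Decidable using (True; toWitness)
open import Relation.Binary.PropositionalEquality

open import Defs

open +-*-Solver

≤-decide : (p q : ℚ) → {True (p ≤? q)} → p ≤ q
≤-decide p q {p≤q} = toWitness p≤q

<-decide : (p q : ℚ) → {True (p <? q)} → p < q
<-decide p q {p<q} = toWitness p<q

0≤1 : 0ℚ ≤ 1ℚ
0≤1 = ≤-decide 0ℚ 1ℚ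

0<1 : 0ℚ < 1ℚ
0<1 = <-decide 0ℚ 1ℚ

p≤q⇒0≤q-p : ∀ {p q} → p ≤ q → 0ℚ ≤ q - p
p≤q⇒0≤q-p {p} {q} p≤q = subst (_≤ q - p) (+-inverseʳ p) (+-monoˡ-≤ (- p) p≤q)

0≤q-p⇒p≤q : ∀ {p q} → 0ℚ ≤ q - p → p ≤ q
0≤q-p⇒p≤q {p} {q} 0≤q-p =
  subst₂ _≤_ (+-identityʳ p) (solve 2 (λ p q → p :+ (q :- p) := q) refl p q)
    (+-monoʳ-≤ p 0≤q-p)

0<q-p⇒p<q : ∀ {p q} → 0ℚ < q - p → p < q
0<q-p⇒p<q {p} {q} 0<q-p =
  subst₂ _<_ (+-identityʳ p) (solve 2 (λ p q → p :+ (q :- p) := q) refl p q)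
    (+-monoʳ-< p 0<q-p)

p<q⇒0<q-p : ∀ {p q} → p < q → 0ℚ < q - p
p<q⇒0<q-p {p} {q} p<q = subst (_< q - p) (+-inverseʳ p) (+-monoˡ-< (- p) p<q)

p<q⇒p-q<0 : ∀ {p q} → p < q → p - q < 0ℚ
p<q⇒p-q<0 {p} {q} p<q = subst (p - q <_) (+-inverseʳ q) (+-monoˡ-< (- q) p<q)

0≤p+q : ∀ {p q} → 0ℚ ≤ p → 0ℚ ≤ q → 0ℚ ≤ p + q
0≤p+q 0≤p 0≤q = +-mono-≤ 0≤p 0≤q

0<p+q : ∀ {p q} → 0ℚ < p → 0ℚ ≤ q → 0ℚ < p + q
0<p+q 0<p 0≤q = +-mono-<-≤ 0<p 0≤q

*-monoˡ-≤-0≤ : ∀ {r p q} → 0ℚ ≤ r → p ≤ q → r * p ≤ r * q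
*-monoˡ-≤-0≤ {r} 0≤r = *-monoˡ-≤-nonNeg r {{nonNegative 0≤r}}

*-monoʳ-≤-0≤ : ∀ {r p q} → 0ℚ ≤ r → p ≤ q → p * r ≤ q * r
*-monoʳ-≤-0≤ {r} 0≤r = *-monoʳ-≤-nonNeg r {{nonNegative 0≤r}}

*-monoˡ-<-0< : ∀ {r p q} → 0ℚ < r → p < q → r * p < r * q
*-monoˡ-<-0< {r} 0<r = *-monoʳ-<-pos r {{positive 0<r}}

*-cancelʳ-≤-0< : ∀ {r p q} → 0ℚ < r → p * r ≤ q * r → p ≤ q
*-cancelʳ-≤-0< {r} 0<r = *-cancelʳ-≤-pos r {{positive 0<r}}

0≤p*q : ∀ {p q} → 0ℚ ≤ p → 0ℚ ≤ q → 0ℚ ≤ p * q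
0≤p*q {p} 0≤p 0≤q = subst (_≤ p * _) (*-zeroʳ p) (*-monoˡ-≤-0≤ 0≤p 0≤q)

0<p*q : ∀ {p q} → 0ℚ < p → 0ℚ < q → 0ℚ < p * q
0<p*q {p} 0<p 0<q = subst (_< p * _) (*-zeroʳ p) (*-monoˡ-<-0< 0<p 0<q)

0≤p*p : ∀ p → 0ℚ ≤ p * p
0≤p*p p with ≤-total 0ℚ p
... | inj₁ 0≤p = 0≤p*q 0≤p 0≤p
... | inj₂ p≤0 =
  nonNegative⁻¹ (p * p) {{nonPos*nonPos⇒nonPos p {{nonPositive p≤0}} p {{nonPositive p≤0}}}}

1≤p*q : ∀ {p q} → 1ℚ ≤ p → 1ℚ ≤ q → 1ℚ ≤ p * q
1≤p*q {p} {q} 1≤p 1≤q =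
  ≤-trans 1≤q (subst (_≤ p * q) (*-identityˡ q) (*-monoʳ-≤-0≤ (≤-trans 0≤1 1≤q) 1≤p))

ℕ→ℚ≡mkℚ : ∀ n → ℕ→ℚ n ≡ mkℚ (+ n) 0 (coprime-sym (1-coprimeTo n))
ℕ→ℚ≡mkℚ n = normalize-coprime (coprime-sym (1-coprimeTo n))

ℕ→ℚ-suc : ∀ n → ℕ→ℚ (suc n) ≡ 1ℚ + ℕ→ℚ n
ℕ→ℚ-suc n rewrite ℕ→ℚ≡mkℚ n = cong (_/ 1) (cong (ℤ._+_ (+ 1)) (sym (ℤₚ.*-identityʳ (+ n))))

ℕ→ℚ-+ : ∀ m n → ℕ→ℚ (m ℕ.+ n) ≡ ℕ→ℚ m + ℕ→ℚ n
ℕ→ℚ-+ zero n = sym (+-identityˡ (ℕ→ℚ n))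
ℕ→ℚ-+ (suc m) n rewrite ℕ→ℚ-suc (m ℕ.+ n) | ℕ→ℚ-suc m | ℕ→ℚ-+ m n =
  sym (+-assoc 1ℚ (ℕ→ℚ m) (ℕ→ℚ n))

ℕ→ℚ-* : ∀ m n → ℕ→ℚ (m ℕ.* n) ≡ ℕ→ℚ m * ℕ→ℚ n
ℕ→ℚ-* zero n = sym (*-zeroˡ (ℕ→ℚ n))
ℕ→ℚ-* (suc m) n rewrite ℕ→ℚ-+ n (m ℕ.* n) | ℕ→ℚ-suc m | ℕ→ℚ-* m n =
  solve 2 (λ m n → n :+ m :* n := (con 1ℚ :+ m) :* n) refl (ℕ→ℚ m) (ℕ→ℚ n)

0≤ℕ→ℚ : ∀ n → 0ℚ ≤ ℕ→ℚ n
0≤ℕ→ℚ n = nonNegative⁻¹ (ℕ→ℚ n) {{normalize-nonNeg n 1}}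

ℕ→ℚ-mono-≤ : ∀ {m n} → m ℕ.≤ n → ℕ→ℚ m ≤ ℕ→ℚ n
ℕ→ℚ-mono-≤ {m} {n} m≤n =
  subst₂ _≤_ (+-identityʳ (ℕ→ℚ m))
    (trans (sym (ℕ→ℚ-+ m (n ℕ.∸ m))) (cong ℕ→ℚ (ℕₚ.m+[n∸m]≡n m≤n)))
    (+-monoʳ-≤ (ℕ→ℚ m) (0≤ℕ→ℚ (n ℕ.∸ m)))

^ℚ-+ : ∀ x m n → x ^ℚ (m ℕ.+ n) ≡ x ^ℚ m * x ^ℚ n
^ℚ-+ x zero n = sym (*-identityˡ _)
^ℚ-+ x (suc m) n rewrite ^ℚ-+ x m n = sym (*-assoc x _ _)

^ℚ-* : ∀ x m n → x ^ℚ (m ℕ.* n) ≡ (x ^ℚ m) ^ℚ n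
^ℚ-* x m zero rewrite ℕₚ.*-zeroʳ m = refl
^ℚ-* x m (suc n) rewrite ℕₚ.*-suc m n | ^ℚ-+ x m (m ℕ.* n) | ^ℚ-* x m n = refl

^ℚ-distrib-* : ∀ x y n → (x * y) ^ℚ n ≡ x ^ℚ n * y ^ℚ n
^ℚ-distrib-* x y zero = refl
^ℚ-distrib-* x y (suc n) rewrite ^ℚ-distrib-* x y n =
  solve 4 (λ x y a b → (x :* y) :* (a :* b) := (x :* a) :* (y :* b)) refl x y (x ^ℚ n) (y ^ℚ n)

1^ℚn≡1 : ∀ n → 1ℚ ^ℚ n ≡ 1ℚ
1^ℚn≡1 zero = refl
1^ℚn≡1 (suc n) rewrite 1^ℚn≡1 n = refl

^ℚ-nonNeg : ∀ {x} n → 0ℚ ≤ x → 0ℚ ≤ x ^ℚ n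
^ℚ-nonNeg zero 0≤x = 0≤1
^ℚ-nonNeg (suc n) 0≤x = 0≤p*q 0≤x (^ℚ-nonNeg n 0≤x)

^ℚ-mono-≤ : ∀ {x y} n → 0ℚ ≤ x → x ≤ y → x ^ℚ n ≤ y ^ℚ n
^ℚ-mono-≤ zero 0≤x x≤y = ≤-refl
^ℚ-mono-≤ (suc n) 0≤x x≤y =
  ≤-trans (*-monoʳ-≤-0≤ (^ℚ-nonNeg n 0≤x) x≤y)
          (*-monoˡ-≤-0≤ (≤-trans 0≤x x≤y) (^ℚ-mono-≤ n 0≤x x≤y))

1≤^ℚ : ∀ {x} n → 1ℚ ≤ x → 1ℚ ≤ x ^ℚ n
1≤^ℚ {x} n 1≤x = subst (_≤ x ^ℚ n) (1^ℚn≡1 n) (^ℚ-mono-≤ n 0≤1 1≤x)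

bernoulli : ∀ h n → 0ℚ ≤ 1ℚ + h → 1ℚ + ℕ→ℚ n * h ≤ (1ℚ + h) ^ℚ n
bernoulli h zero _ = ≤-reflexive (solve 1 (λ h → con 1ℚ :+ con 0ℚ :* h := con 1ℚ) refl h)
bernoulli h (suc n) 0≤1+h = 0≤q-p⇒p≤q (begin
  0ℚ                                          ≤⟨ 0≤p*q (0≤ℕ→ℚ n) (0≤p*p h) ⟩
  ℕ→ℚ n * (h * h)                             ≡⟨ step-identity ⟩
  (1ℚ + h) * (1ℚ + ℕ→ℚ n * h) - (1ℚ + ℕ→ℚ (suc n) * h)
    ≤⟨ +-monoˡ-≤ _ (*-monoˡ-≤-0≤ 0≤1+h (bernoulli h n 0≤1+h)) ⟩
  (1ℚ + h) ^ℚ suc n - (1ℚ + ℕ→ℚ (suc n) * h) ∎)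
  where
  open ≤-Reasoning
  step-identity : ℕ→ℚ n * (h * h) ≡ (1ℚ + h) * (1ℚ + ℕ→ℚ n * h) - (1ℚ + ℕ→ℚ (suc n) * h)
  step-identity rewrite ℕ→ℚ-suc n =
    solve 2 (λ n h → n :* (h :* h)
                 := (con 1ℚ :+ h) :* (con 1ℚ :+ n :* h) :- (con 1ℚ :+ (con 1ℚ :+ n) :* h))
      refl (ℕ→ℚ n) h

[1+t*v]^s≤[1+v]^[t*s] : ∀ {v} t s → 0ℚ ≤ v → (1ℚ + ℕ→ℚ t * v) ^ℚ s ≤ (1ℚ + v) ^ℚ (t ℕ.* s)
[1+t*v]^s≤[1+v]^[t*s] {v} t s 0≤v = subst ((1ℚ + ℕ→ℚ t * v) ^ℚ s ≤_) (sym (^ℚ-* (1ℚ + v) t s))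
  (^ℚ-mono-≤ s (0≤p+q 0≤1 (0≤p*q (0≤ℕ→ℚ t) 0≤v)) (bernoulli v t (0≤p+q 0≤1 0≤v)))

inv-pos : ∀ {q} → 0ℚ < q → 0ℚ < inv q
inv-pos {q} 0<q with q ≟ 0ℚ
... | yes q≡0 = ⊥-elim (<-irrefl (sym q≡0) 0<q)
... | no _    = positive⁻¹ _ {{1/pos⇒pos q {{positive 0<q}}}}

inv-inverseʳ : ∀ {q} → 0ℚ < q → q * inv q ≡ 1ℚ
inv-inverseʳ {q} 0<q with q ≟ 0ℚ
... | yes q≡0 = ⊥-elim (<-irrefl (sym q≡0) 0<q)
... | no q≢0  = *-inverseʳ q {{≢-nonZero q≢0}}

1-inv[N+1]≡N*inv[N+1] : ∀ {N} → 0ℚ < N → 1ℚ - inv (N + 1ℚ) ≡ N * inv (N + 1ℚ)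
1-inv[N+1]≡N*inv[N+1] {N} 0<N = begin
  1ℚ - y                  ≡⟨ cong (_- y) (sym (inv-inverseʳ (0<p+q 0<N 0≤1))) ⟩
  (N + 1ℚ) * y - y        ≡⟨ solve 2 (λ N y → (N :+ con 1ℚ) :* y :- y := N :* y) refl N y ⟩
  N * y                   ∎
  where
  open ≡-Reasoning
  y = inv (N + 1ℚ)

[1+inv[N]]*[1-inv[N+1]]≡1 : ∀ {N} → 0ℚ < N → (1ℚ + inv N) * (1ℚ - inv (N + 1ℚ)) ≡ 1ℚ
[1+inv[N]]*[1-inv[N+1]]≡1 {N} 0<N = begin
  (1ℚ + u) * (1ℚ - y)     ≡⟨ cong ((1ℚ + u) *_) (1-inv[N+1]≡N*inv[N+1] 0<N) ⟩
  (1ℚ + u) * (N * y)      ≡⟨ solve 3 (λ N u y → (con 1ℚ :+ u) :* (N :* y) := (N :+ N :* u) :* y) refl N u y ⟩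
  (N + N * u) * y         ≡⟨ cong (λ e → (N + e) * y) (inv-inverseʳ 0<N) ⟩
  (N + 1ℚ) * y            ≡⟨ inv-inverseʳ (0<p+q 0<N 0≤1) ⟩
  1ℚ                      ∎
  where
  open ≡-Reasoning
  u = inv N
  y = inv (N + 1ℚ)

[1+inv[N]]^t*[1-t*inv[N+1]]≤1 : ∀ {N} t → 0ℚ < N →
  (1ℚ + inv N) ^ℚ t * (1ℚ - ℕ→ℚ t * inv (N + 1ℚ)) ≤ 1ℚ
[1+inv[N]]^t*[1-t*inv[N+1]]≤1 {N} t 0<N = begin
  (1ℚ + u) ^ℚ t * (1ℚ - ℕ→ℚ t * y)
    ≡⟨ cong (λ e → (1ℚ + u) ^ℚ t * (1ℚ + e)) (neg-distribʳ-* (ℕ→ℚ t) y) ⟩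
  (1ℚ + u) ^ℚ t * (1ℚ + ℕ→ℚ t * - y)
    ≤⟨ *-monoˡ-≤-0≤ (^ℚ-nonNeg t (0≤p+q 0≤1 (<⇒≤ (inv-pos 0<N)))) (bernoulli (- y) t 0≤1-y) ⟩
  (1ℚ + u) ^ℚ t * (1ℚ - y) ^ℚ t   ≡⟨ sym (^ℚ-distrib-* (1ℚ + u) (1ℚ - y) t) ⟩
  ((1ℚ + u) * (1ℚ - y)) ^ℚ t       ≡⟨ cong (_^ℚ t) ([1+inv[N]]*[1-inv[N+1]]≡1 0<N) ⟩
  1ℚ ^ℚ t                         ≡⟨ 1^ℚn≡1 t ⟩
  1ℚ                              ∎
  where
  open ≤-Reasoning
  u = inv N
  y = inv (N + 1ℚ)
  0≤1-y : 0ℚ ≤ 1ℚ - y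
  0≤1-y = subst (0ℚ ≤_) (sym (1-inv[N+1]≡N*inv[N+1] 0<N))
    (0≤p*q (<⇒≤ 0<N) (<⇒≤ (inv-pos (0<p+q 0<N 0≤1))))

-- L is a lower bound for t/M, the base of the outer power in f being 1 + 1/M;
-- 56c + 20 = 20(14/5 · c + 1) comes from the bound 14/5 on the inner factor.
IsFWitness : ℚ → ℚ → Set
IsFWitness c L = 0ℚ ≤ L
                × L * (ℕ→ℚ 56 * c + ℕ→ℚ 20) ≤ ℕ→ℚ 5 * c + ℕ→ℚ 5
                × ℕ→ℚ 5 * c + ℕ→ℚ 5 < c * (1ℚ + L) ^ℚ 20

module Estimates (m c z : ℚ) (d t : ℕ) (1≤m : 1ℚ ≤ m) (1≤c : 1ℚ ≤ c)
                 (z≡5c+5 : z ≡ ℕ→ℚ 5 * c + ℕ→ℚ 5) (d≡t*20 : d ≡ t ℕ.* 20) (d≡m*z : ℕ→ℚ d ≡ m * z)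
                 where

  0≤c : 0ℚ ≤ c
  0≤c = ≤-trans 0≤1 1≤c

  0<m : 0ℚ < m
  0<m = <-≤-trans 0<1 1≤m

  0<z : 0ℚ < z
  0<z = subst (0ℚ <_) (sym z≡5c+5)
    (+-mono-≤-< (0≤p*q (≤-decide 0ℚ (ℕ→ℚ 5)) 0≤c) (<-decide 0ℚ (ℕ→ℚ 5)))

  ℕ→ℚ[d]≡t*20 : ℕ→ℚ d ≡ ℕ→ℚ t * ℕ→ℚ 20
  ℕ→ℚ[d]≡t*20 = trans (cong ℕ→ℚ d≡t*20) (ℕ→ℚ-* t 20)

  N : ℚ
  N = m * z + m - 1ℚ

  0<N : 0ℚ < N
  0<N = subst (0ℚ <_) (sym (+-assoc (m * z) m (- 1ℚ)))
    (0<p+q (0<p*q 0<m 0<z) (p≤q⇒0≤q-p 1≤m))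

  0<N+1 : 0ℚ < N + 1ℚ
  0<N+1 = 0<p+q 0<N 0≤1

  d≤N+1 : ℕ→ℚ d ≤ N + 1ℚ
  d≤N+1 = 0≤q-p⇒p≤q (subst (0ℚ ≤_) gap (<⇒≤ 0<m))
    where
    gap : m ≡ N + 1ℚ - ℕ→ℚ d
    gap rewrite d≡m*z =
      solve 2 (λ m z → m := m :* z :+ m :- con 1ℚ :+ con 1ℚ :- m :* z) refl m z

  I : ℚ
  I = (1ℚ + inv N) ^ℚ d

  1≤1+inv[N] : 1ℚ ≤ 1ℚ + inv N
  1≤1+inv[N] = subst (_≤ 1ℚ + inv N) (+-identityʳ 1ℚ) (+-monoʳ-≤ 1ℚ (<⇒≤ (inv-pos 0<N)))

  t*inv[N+1]≤1/20 : ℕ→ℚ t * inv (N + 1ℚ) ≤ + 1 / 20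
  t*inv[N+1]≤1/20 = *-cancelʳ-≤-0< (<-decide 0ℚ (ℕ→ℚ 20)) (begin
    ℕ→ℚ t * y * ℕ→ℚ 20  ≡⟨ solve 2 (λ t y → t :* y :* con (ℕ→ℚ 20) := t :* con (ℕ→ℚ 20) :* y) refl (ℕ→ℚ t) y ⟩
    ℕ→ℚ t * ℕ→ℚ 20 * y  ≡⟨ cong (_* y) (sym ℕ→ℚ[d]≡t*20) ⟩
    ℕ→ℚ d * y       ≤⟨ *-monoʳ-≤-0≤ (<⇒≤ (inv-pos 0<N+1)) d≤N+1 ⟩
    (N + 1ℚ) * y    ≡⟨ inv-inverseʳ 0<N+1 ⟩
    + 1 / 20 * ℕ→ℚ 20   ∎)
    where
    open ≤-Reasoning
    y = inv (N + 1ℚ)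

  [1+inv[N]]^t≤20/19 : (1ℚ + inv N) ^ℚ t ≤ + 20 / 19
  [1+inv[N]]^t≤20/19 = *-cancelʳ-≤-0< (<-decide 0ℚ (+ 19 / 20)) (begin
    (1ℚ + inv N) ^ℚ t * (+ 19 / 20)
      ≤⟨ *-monoˡ-≤-0≤ (^ℚ-nonNeg t (≤-trans 0≤1 1≤1+inv[N]))
                      (+-monoʳ-≤ 1ℚ (neg-antimono-≤ t*inv[N+1]≤1/20)) ⟩
    (1ℚ + inv N) ^ℚ t * (1ℚ - ℕ→ℚ t * inv (N + 1ℚ)) ≤⟨ [1+inv[N]]^t*[1-t*inv[N+1]]≤1 t 0<N ⟩
    + 20 / 19 * (+ 19 / 20)                        ∎)
    where open ≤-Reasoning

  I≤14/5 : I ≤ + 14 / 5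
  I≤14/5 = begin
    (1ℚ + inv N) ^ℚ d           ≡⟨ cong ((1ℚ + inv N) ^ℚ_) d≡t*20 ⟩
    (1ℚ + inv N) ^ℚ (t ℕ.* 20)  ≡⟨ ^ℚ-* (1ℚ + inv N) t 20 ⟩
    ((1ℚ + inv N) ^ℚ t) ^ℚ 20   ≤⟨ ^ℚ-mono-≤ 20 (^ℚ-nonNeg t (≤-trans 0≤1 1≤1+inv[N])) [1+inv[N]]^t≤20/19 ⟩
    (+ 20 / 19) ^ℚ 20          ≤⟨ ≤-decide _ _ ⟩
    + 14 / 5                   ∎
    where open ≤-Reasoning

  g-negative : c * I - z < 0ℚ
  g-negative = p<q⇒p-q<0 (begin-strict
    c * I            ≤⟨ *-monoˡ-≤-0≤ 0≤c I≤14/5 ⟩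
    c * (+ 14 / 5)   <⟨ 0<q-p⇒p<q (subst (0ℚ <_) (sym gap)
                          (0<p+q (<-decide 0ℚ (ℕ→ℚ 5)) (0≤p*q (≤-decide 0ℚ (+ 11 / 5)) 0≤c))) ⟩
    ℕ→ℚ 5 * c + ℕ→ℚ 5    ≡⟨ sym z≡5c+5 ⟩
    z                ∎)
    where
    open ≤-Reasoning
    gap : ℕ→ℚ 5 * c + ℕ→ℚ 5 - c * (+ 14 / 5) ≡ ℕ→ℚ 5 + (+ 11 / 5) * c
    gap = solve 1 (λ c → con (ℕ→ℚ 5) :* c :+ con (ℕ→ℚ 5) :- c :* con (+ 14 / 5)
                       := con (ℕ→ℚ 5) :+ con (+ 11 / 5) :* c) refl c

  M : ℚ
  M = m * c * I + m - 1ℚ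

  0<M : 0ℚ < M
  0<M = subst (0ℚ <_) (sym (+-assoc (m * c * I) m (- 1ℚ)))
    (0<p+q (<-≤-trans 0<1 (1≤p*q (1≤p*q 1≤m 1≤c) (1≤^ℚ d 1≤1+inv[N]))) (p≤q⇒0≤q-p 1≤m))

  M≤m*[14/5*c+1] : M ≤ m * (+ 14 / 5 * c + 1ℚ)
  M≤m*[14/5*c+1] = 0≤q-p⇒p≤q (subst (0ℚ ≤_) (sym gap)
    (0≤p+q (0≤p*q (0≤p*q (<⇒≤ 0<m) 0≤c) (p≤q⇒0≤q-p I≤14/5)) 0≤1))
    where
    gap : m * (+ 14 / 5 * c + 1ℚ) - M ≡ m * c * (+ 14 / 5 - I) + 1ℚ
    gap = solve 3 (λ m c I → m :* (con (+ 14 / 5) :* c :+ con 1ℚ) :- (m :* c :* I :+ m :- con 1ℚ)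
                         := m :* c :* (con (+ 14 / 5) :- I) :+ con 1ℚ) refl m c I

  L≤t*inv[M] : ∀ L → L * (ℕ→ℚ 56 * c + ℕ→ℚ 20) ≤ ℕ→ℚ 5 * c + ℕ→ℚ 5 → L ≤ ℕ→ℚ t * inv M
  L≤t*inv[M] L hL = *-cancelʳ-≤-0< (0<p*q 0<56c+20 0<m) (begin
    L * ((ℕ→ℚ 56 * c + ℕ→ℚ 20) * m)   ≡⟨ sym (*-assoc L _ m) ⟩
    L * (ℕ→ℚ 56 * c + ℕ→ℚ 20) * m     ≤⟨ *-monoʳ-≤-0≤ (<⇒≤ 0<m) hL ⟩
    (ℕ→ℚ 5 * c + ℕ→ℚ 5) * m           ≡⟨ [5c+5]*m≡m*z ⟩
    m * z                     ≡⟨ trans (sym d≡m*z) ℕ→ℚ[d]≡t*20 ⟩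
    ℕ→ℚ t * ℕ→ℚ 20                ≡⟨ cong (_* ℕ→ℚ 20) (sym (*-identityʳ (ℕ→ℚ t))) ⟩
    ℕ→ℚ t * 1ℚ * ℕ→ℚ 20           ≡⟨ cong (λ e → ℕ→ℚ t * e * ℕ→ℚ 20) (sym (inv-inverseʳ 0<M)) ⟩
    ℕ→ℚ t * (M * v) * ℕ→ℚ 20      ≡⟨ solve 3 (λ t M v → t :* (M :* v) :* con (ℕ→ℚ 20) := t :* v :* (con (ℕ→ℚ 20) :* M))
                                   refl (ℕ→ℚ t) M v ⟩
    ℕ→ℚ t * v * (ℕ→ℚ 20 * M)
      ≤⟨ *-monoˡ-≤-0≤ (0≤p*q (0≤ℕ→ℚ t) (<⇒≤ (inv-pos 0<M)))
                      (*-monoˡ-≤-0≤ (≤-decide 0ℚ (ℕ→ℚ 20)) M≤m*[14/5*c+1]) ⟩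
    ℕ→ℚ t * v * (ℕ→ℚ 20 * (m * (+ 14 / 5 * c + 1ℚ)))
      ≡⟨ solve 4 (λ t v m c → t :* v :* (con (ℕ→ℚ 20) :* (m :* (con (+ 14 / 5) :* c :+ con 1ℚ)))
                            := t :* v :* ((con (ℕ→ℚ 56) :* c :+ con (ℕ→ℚ 20)) :* m)) refl (ℕ→ℚ t) v m c ⟩
    ℕ→ℚ t * v * ((ℕ→ℚ 56 * c + ℕ→ℚ 20) * m) ∎)
    where
    open ≤-Reasoning
    v = inv M
    0<56c+20 : 0ℚ < ℕ→ℚ 56 * c + ℕ→ℚ 20
    0<56c+20 = subst (0ℚ <_) (+-comm (ℕ→ℚ 20) (ℕ→ℚ 56 * c)) (0<p+q (<-decide 0ℚ (ℕ→ℚ 20)) (0≤p*q (≤-decide 0ℚ (ℕ→ℚ 56)) 0≤c))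
    [5c+5]*m≡m*z : (ℕ→ℚ 5 * c + ℕ→ℚ 5) * m ≡ m * z
    [5c+5]*m≡m*z = trans (*-comm _ m) (cong (m *_) (sym z≡5c+5))

  f-positive : ∀ {L} → IsFWitness c L → 0ℚ < c * (1ℚ + inv M) ^ℚ d - z
  f-positive {L} (0≤L , hL , L-large) = p<q⇒0<q-p (begin-strict
    z                               ≡⟨ z≡5c+5 ⟩
    ℕ→ℚ 5 * c + ℕ→ℚ 5               <⟨ L-large ⟩
    c * (1ℚ + L) ^ℚ 20
      ≤⟨ *-monoˡ-≤-0≤ 0≤c (^ℚ-mono-≤ 20 (0≤p+q 0≤1 0≤L) (+-monoʳ-≤ 1ℚ (L≤t*inv[M] L hL))) ⟩
    c * (1ℚ + ℕ→ℚ t * inv M) ^ℚ 20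
      ≤⟨ *-monoˡ-≤-0≤ 0≤c ([1+t*v]^s≤[1+v]^[t*s] t 20 (<⇒≤ (inv-pos 0<M))) ⟩
    c * (1ℚ + inv M) ^ℚ (t ℕ.* 20)  ≡⟨ cong (λ e → c * (1ℚ + inv M) ^ℚ e) (sym d≡t*20) ⟩
    c * (1ℚ + inv M) ^ℚ d           ∎)
    where open ≤-Reasoning

1≤mm : ∀ k b → 1ℚ ≤ mm k b
1≤mm k b = ℕ→ℚ-mono-≤ (ℕₚ.m^n>0 2 (k ℕ.∸ 2 ℕ.* b))

2^n-1≤cc : ∀ {n} b → n ℕ.≤ b → ℕ→ℚ (2 ℕ.^ n) - 1ℚ ≤ cc b
2^n-1≤cc b n≤b = +-monoˡ-≤ (- 1ℚ) (ℕ→ℚ-mono-≤ (ℕₚ.^-monoʳ-≤ 2 n≤b))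

zstar≡5*cc+5 : ∀ b → zstar b ≡ ℕ→ℚ 5 * cc b + ℕ→ℚ 5
zstar≡5*cc+5 b = trans (ℕ→ℚ-* 5 (2 ℕ.^ b))
  (solve 1 (λ x → con (ℕ→ℚ 5) :* x := con (ℕ→ℚ 5) :* (x :- con 1ℚ) :+ con (ℕ→ℚ 5)) refl (ℕ→ℚ (2 ℕ.^ b)))

b≤k∸b : ∀ k b → 2 ℕ.* b ℕ.≤ k → b ℕ.≤ k ℕ.∸ b
b≤k∸b k b 2b≤k = subst (ℕ._≤ k ℕ.∸ b) (ℕₚ.m+n∸n≡m b b)
  (ℕₚ.∸-monoˡ-≤ b (subst (ℕ._≤ k) (cong (b ℕ.+_) (ℕₚ.+-identityʳ b)) 2b≤k))

k∸b≡k∸2b+b : ∀ k b → 2 ℕ.* b ℕ.≤ k → k ℕ.∸ b ≡ k ℕ.∸ 2 ℕ.* b ℕ.+ b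
k∸b≡k∸2b+b k b 2b≤k = begin
  k ℕ.∸ b                    ≡⟨ sym (ℕₚ.m∸n+n≡m (b≤k∸b k b 2b≤k)) ⟩
  k ℕ.∸ b ℕ.∸ b ℕ.+ b        ≡⟨ cong (ℕ._+ b) (ℕₚ.∸-+-assoc k b b) ⟩
  k ℕ.∸ (b ℕ.+ b) ℕ.+ b      ≡⟨ cong (λ n → k ℕ.∸ (b ℕ.+ n) ℕ.+ b) (sym (ℕₚ.+-identityʳ b)) ⟩
  k ℕ.∸ 2 ℕ.* b ℕ.+ b        ∎
  where open ≡-Reasoning

dd≡mm*zstar : ∀ k b → 2 ℕ.* b ℕ.≤ k → ℕ→ℚ (dd k b) ≡ mm k b * zstar b
dd≡mm*zstar k b 2b≤k = trans (cong ℕ→ℚ dd≡) (ℕ→ℚ-* (2 ℕ.^ (k ℕ.∸ 2 ℕ.* b)) (5 ℕ.* 2 ℕ.^ b))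
  where
  open ≡-Reasoning
  dd≡ : 5 ℕ.* 2 ℕ.^ (k ℕ.∸ b) ≡ 2 ℕ.^ (k ℕ.∸ 2 ℕ.* b) ℕ.* (5 ℕ.* 2 ℕ.^ b)
  dd≡ = begin
    5 ℕ.* 2 ℕ.^ (k ℕ.∸ b)                          ≡⟨ cong (λ n → 5 ℕ.* 2 ℕ.^ n) (k∸b≡k∸2b+b k b 2b≤k) ⟩
    5 ℕ.* 2 ℕ.^ (k ℕ.∸ 2 ℕ.* b ℕ.+ b)              ≡⟨ cong (5 ℕ.*_) (ℕₚ.^-distribˡ-+-* 2 (k ℕ.∸ 2 ℕ.* b) b) ⟩
    5 ℕ.* (2 ℕ.^ (k ℕ.∸ 2 ℕ.* b) ℕ.* 2 ℕ.^ b)      ≡⟨ x∙yz≈y∙xz 5 (2 ℕ.^ (k ℕ.∸ 2 ℕ.* b)) (2 ℕ.^ b) ⟩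
    2 ℕ.^ (k ℕ.∸ 2 ℕ.* b) ℕ.* (5 ℕ.* 2 ℕ.^ b)      ∎

dd≡2^r*20 : ∀ k b {r} → k ℕ.∸ b ≡ 2 ℕ.+ r → dd k b ≡ 2 ℕ.^ r ℕ.* 20
dd≡2^r*20 k b {r} k∸b≡2+r rewrite k∸b≡2+r =
  trans (sym (ℕₚ.*-assoc 5 2 (2 ℕ.* 2 ℕ.^ r)))
    (trans (sym (ℕₚ.*-assoc 10 2 (2 ℕ.^ r))) (ℕₚ.*-comm 20 (2 ℕ.^ r)))

-- L = (5c + 5)/(56c + 20) for the three smallest values of c; for c ≥ 15 its limit 5/56 suffices.
fWitness : ∀ b → 1 ℕ.≤ b → Σ[ L ∈ ℚ ] IsFWitness (cc b) L
fWitness 1 _ = + 5 / 38 , ≤-decide _ _ , ≤-decide _ _ , <-decide _ _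
fWitness 2 _ = + 5 / 47 , ≤-decide _ _ , ≤-decide _ _ , <-decide _ _
fWitness 3 _ = + 10 / 103 , ≤-decide _ _ , ≤-decide _ _ , <-decide _ _
fWitness b@(suc (suc (suc (suc b′)))) _ = + 5 / 56 , ≤-decide _ _ , L-bound , L-large
  where
  c = cc b
  15≤c : ℕ→ℚ 15 ≤ c
  15≤c = 2^n-1≤cc {4} b (ℕₚ.m≤m+n 4 b′)
  L-bound : + 5 / 56 * (ℕ→ℚ 56 * c + ℕ→ℚ 20) ≤ ℕ→ℚ 5 * c + ℕ→ℚ 5
  L-bound = 0≤q-p⇒p≤q (subst (0ℚ ≤_) (sym gap) (≤-decide 0ℚ (+ 45 / 14)))
    where
    gap : ℕ→ℚ 5 * c + ℕ→ℚ 5 - + 5 / 56 * (ℕ→ℚ 56 * c + ℕ→ℚ 20) ≡ + 45 / 14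
    gap = solve 1 (λ c → con (ℕ→ℚ 5) :* c :+ con (ℕ→ℚ 5) :- con (+ 5 / 56) :* (con (ℕ→ℚ 56) :* c :+ con (ℕ→ℚ 20))
                      := con (+ 45 / 14)) refl c
  L-large : ℕ→ℚ 5 * c + ℕ→ℚ 5 < c * (1ℚ + + 5 / 56) ^ℚ 20
  L-large = begin-strict
    ℕ→ℚ 5 * c + ℕ→ℚ 5    <⟨ 0<q-p⇒p<q (subst (0ℚ <_) (sym gap)
                              (0<p+q (<-decide 0ℚ (+ 5 / 2)) (0≤p*q (≤-decide 0ℚ (+ 1 / 2)) (p≤q⇒0≤q-p 15≤c)))) ⟩
    c * (+ 11 / 2)        ≤⟨ *-monoˡ-≤-0≤ (≤-trans (≤-decide 0ℚ (ℕ→ℚ 15)) 15≤c) (≤-decide _ _) ⟩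
    c * (1ℚ + + 5 / 56) ^ℚ 20 ∎
    where
    open ≤-Reasoning
    gap : c * (+ 11 / 2) - (ℕ→ℚ 5 * c + ℕ→ℚ 5) ≡ + 5 / 2 + + 1 / 2 * (c - ℕ→ℚ 15)
    gap = solve 1 (λ c → c :* con (+ 11 / 2) :- (con (ℕ→ℚ 5) :* c :+ con (ℕ→ℚ 5))
                      := con (+ 5 / 2) :+ con (+ 1 / 2) :* (c :- con (ℕ→ℚ 15))) refl c

ffun>0×gfun<0 : ∀ {k b r} → 1 ℕ.≤ b → 2 ℕ.* b ℕ.≤ k → k ℕ.∸ b ≡ 2 ℕ.+ r →
  (ffun k b (zstar b) > 0ℚ) × (gfun k b (zstar b) < 0ℚ)
ffun>0×gfun<0 {k} {b} {r} 1≤b 2b≤k k∸b≡2+r = f-positive (proj₂ (fWitness b 1≤b)) , g-negative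
  where
  open Estimates (mm k b) (cc b) (zstar b) (dd k b) (2 ℕ.^ r) (1≤mm k b) (2^n-1≤cc b 1≤b)
                 (zstar≡5*cc+5 b) (dd≡2^r*20 k b k∸b≡2+r) (dd≡mm*zstar k b 2b≤k)

[k,b]≡[2,1]⊎k∸b≡2+r : ∀ {k b} → 1 ℕ.≤ b → 2 ℕ.* b ℕ.≤ k →
  (k ≡ 2 × b ≡ 1) ⊎ Σ[ r ∈ ℕ ] k ℕ.∸ b ≡ 2 ℕ.+ r
[k,b]≡[2,1]⊎k∸b≡2+r {k} {b} 1≤b 2b≤k with k ℕ.∸ b in k∸b≡
... | 0           = ⊥-elim (ℕₚ.<⇒≱ 1≤b (subst (b ℕ.≤_) k∸b≡ (b≤k∸b k b 2b≤k)))
... | 1           = inj₁ (k≡2 , b≡1)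
  where
  b≡1 : b ≡ 1
  b≡1 = ℕₚ.≤-antisym (subst (b ℕ.≤_) k∸b≡ (b≤k∸b k b 2b≤k)) 1≤b
  k≡2 : k ≡ 2
  k≡2 = trans (sym (ℕₚ.m∸n+n≡m (ℕₚ.≤-trans (ℕₚ.m≤n*m b 2) 2b≤k))) (cong₂ ℕ._+_ k∸b≡ b≡1)
... | suc (suc r) = inj₂ (r , refl)

-- For (k, b) = (2, 1) the exponent d = 10 is not a multiple of 20; both values are computed.
lemma5 : (k b : ℕ) → 2 ℕ.≤ k → 1 ℕ.≤ b → 2 ℕ.* b ℕ.≤ k →
    (ffun k b (zstar b) > 0ℚ) × (gfun k b (zstar b) < 0ℚ)
lemma5 k b _ 1≤b 2b≤k with [k,b]≡[2,1]⊎k∸b≡2+r 1≤b 2b≤k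
... | inj₁ (refl , refl)  = <-decide _ _ , <-decide _ _
... | inj₂ (r , k∸b≡2+r) = ffun>0×gfun<0 1≤b 2b≤k k∸b≡2+r
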